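{- Let $n\ge2$, let $f(x)=x\left(\frac{x-n}{2}-\frac1n\right)$, and define $H(S|T)=f(|S|)+f(|T|)+1$ for bisubsets $S|T$ of $[n]$ (and also for $\emptyset|[n]$ and $[n]|\emptyset$). Then $H$ weakly satisfies all supermodular and up-down inequalities: $I_{\mathsf{B}}(H)\ge0$ for every bisequence $\mathsf{B}$ of either type.
   Context: ($H$ is the support function of the harmonic polytope $H_{n,n}$ translated into $M_n\times M_n$.) A bisequence of $[n]$ is a sequence of nonempty subsets of $[n]$ such that every element lies in at least one and at most two parts and some element lies in exactly one part. A bisubset is a bisequence $S|T$ with two parts. (A) Supermodular inequalities: for a bisequence $\mathsf{B}$ with $2n-2$ parts, all singletons except one part $\{i,j\}$ ($i\ne j$), let $S$ be the union of the parts before $\{i,j\}$ and $T$ the union of those after; $I_{\mathsf{B}}(h)=h(S|T\cup\{i,j\})+h(S\cup\{i,j\}|T)-h(S\cup\{i\}|T\cup\{j\})-h(S\cup\{j\}|T\cup\{i\})$. (B) Up-down inequalities: for a bisequence $\mathsf{B}$ with $2n-2$ singleton parts (so exactly two elements appear once), let $\overline{\mathsf{B}}=c_1|\cdots|c_{2n}$ be obtained by replacing each once-occurring element by two consecutive copies; call the first occurrence of each element unbarred and the second barred. For $1\le m\le 2n-1$ let $S_m=\{c_1,\dots,c_m\}$, $T_m=\{c_{m+1},\dots,c_{2n}\}$; $m$ is an up position if $c_m$ is unbarred and $c_{m+1}$ barred, a down position if $c_m$ barred and $c_{m+1}$ unbarred. $I_{\mathsf{B}}(h)=\sum_{m\text{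 down}}h(S_m|T_m)-\sum_{m\text{ up}}h(S_m|T_m)$. -}

module Defs where

open import Data.Bool using (Bool; true; false; if_then_else_)
open import Data.Nat as ℕ using (ℕ; zero; suc)
open import Data.Integer using (+_)
open import Data.Rational using (ℚ; 0ℚ; 1ℚ; ½; _/_; _+_; _-_; _*_; -_)
open import Data.Fin using (Fin; _≟_)
open import Relation.Nullary using (yes; no)
open import Data.Fin.Subset using (Subset; ⁅_⁆; _∪_; ⊥; ∣_∣; Nonempty)
open import Data.Vec using (lookup)
open import Data.List using (List; []; _∷_; map; zipWith; take; drop; length; foldr; concatMap; upTo)
open import Data.List.Relation.Unary.All using (All)
open import Data.Product using (_×_; ∃)
open import Relation.Binary.PropositionalEquality using (_≡_)

ℕ→ℚ : ℕ → ℚ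
ℕ→ℚ m = + m / 1

-- 1/n (used only for n ≥ 2; value at 0 is irrelevant)
recipℕ : ℕ → ℚ
recipℕ zero = 0ℚ
recipℕ (suc m) = + 1 / suc m

f : ℕ → ℕ → ℚ
f n x = ℕ→ℚ x * (((ℕ→ℚ x - ℕ→ℚ n) * ½) - recipℕ n)

H : (n : ℕ) → Subset n → Subset n → ℚ
H n S T = (f n (∣ S ∣) + f n (∣ T ∣)) + 1ℚ

occ : ∀ {n} → Fin n → List (Subset n) → ℕ
occ x [] = 0
occ x (P ∷ B) = if lookup P x then suc (occ x B) else occ x B

IsBisequence : ∀ {n} → List (Subset n) → Set
IsBisequence {n} B =
  All Nonempty B
  × (∀ (x : Fin n) → 1 ℕ.≤ occ x B × occ x B ℕ.≤ 2)
  × ∃ (λ (x : Fin n) → occ x B ≡ 1)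

setOf : ∀ {n} → List (Fin n) → Subset n
setOf = foldr (λ x s → ⁅ x ⁆ ∪ s) ⊥

supermodularBisequence : ∀ {n} → List (Fin n) → Fin n → Fin n → List (Fin n) → List (Subset n)
supermodularBisequence L i j R = map ⁅_⁆ L Data.List.++ ((⁅ i ⁆ ∪ ⁅ j ⁆) ∷ map ⁅_⁆ R)

I-supermodular : ∀ {n} → (Subset n → Subset n → ℚ) → List (Fin n) → Fin n → Fin n → List (Fin n) → ℚ
I-supermodular h L i j R =
  let S = setOf L ; T = setOf R ; ij = ⁅ i ⁆ ∪ ⁅ j ⁆ in
  h S (T ∪ ij) + h (S ∪ ij) T - h (S ∪ ⁅ i ⁆) (T ∪ ⁅ j ⁆) - h (S ∪ ⁅ j ⁆) (T ∪ ⁅ i ⁆)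

-- (B) up-down inequality for the bisequence ⁅c₁⁆ | … | ⁅c_{2n-2}⁆

count : ∀ {n} → Fin n → List (Fin n) → ℕ
count x [] = 0
count x (y ∷ ys) with x ≟ y
... | yes _ = suc (count x ys)
... | no _ = count x ys

bar : ∀ {n} → List (Fin n) → List (Fin n)
bar c = concatMap (λ x → if count x c ℕ.≡ᵇ 1 then x ∷ x ∷ [] else x ∷ []) c

barredFlags : ∀ {n} → List (Fin n) → List (Fin n) → List Bool
barredFlags seen [] = []
barredFlags seen (x ∷ xs) = (1 ℕ.≤ᵇ count x seen) ∷ barredFlags (x ∷ seen) xs

sumℚ : List ℚ → ℚ
sumℚ = foldr _+_ 0ℚ

-- weight of position m from the flags of c_m and c_{m+1}:
-- down (barred, unbarred) = +1, up (unbarred, barred) = -1, otherwise 0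
weight : Bool → Bool → ℚ
weight true false = 1ℚ
weight false true = - 1ℚ
weight _ _ = 0ℚ

consecutiveWeights : List Bool → List ℚ
consecutiveWeights (a ∷ b ∷ rest) = weight a b ∷ consecutiveWeights (b ∷ rest)
consecutiveWeights _ = []

I-updown : ∀ {n} → (Subset n → Subset n → ℚ) → List (Fin n) → ℚ
I-updown h c =
  let cb = bar c in
  sumℚ (zipWith _*_ (consecutiveWeights (barredFlags [] cb))
                   (map (λ k → h (setOf (take (suc k) cb)) (setOf (drop (suc k) cb)))
                        (upTo (length cb ℕ.∸ 1))))

{-# OPTIONS --safe #-}
module Submission where

-- H(S|T) only sees |S| and |T|, through a quadratic f whose second difference is 1.
-- A supermodular expression is therefore the sum of a second difference of f over S and
-- one over T, i.e. [i ∉ S][j ∉ S] + [i ∉ T][j ∉ T] ≥ 0, for arbitrary S and T.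
-- For an up-down inequality every letter occurs exactly twice in B̄, so S_m is constant
-- along runs of barred letters and T_m along runs of unbarred ones.  For a separable
-- h(S|T) = φ(S) + ψ(T) the alternating sum over down and up positions then telescopes
-- to -φ([n]) - ψ([n]) = -H([n]|[n]) = 1, since f(n) = -1.

open import Defs
open import Data.Bool using (Bool; true; false; if_then_else_; _∨_)
open import Data.Bool.Properties using (∨-identityʳ)
open import Data.Empty using (⊥-elim)
open import Data.Fin using (Fin; zero; suc; _≟_)
open import Data.Fin.Subset using (Subset; ⁅_⁆; _∪_; ⊥; ⊤; ∣_∣; _∈_)
open import Data.Fin.Subset.Properties
  using ( ∪-identityˡ; ∪-identityʳ; ∪-assoc; ∪-comm; ⊆-antisym; ⊆⊤; p⊆p∪q
        ; x∈p∪q⁺; x∈p∪q⁻; x∈⁅x⁆; x∈⁅y⁆⇒x≡y; ∣⊤∣≡n )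
import Data.Integer as ℤ
import Data.Integer.Properties as ℤ
open import Data.List using (List; []; _∷_; _++_; map; zipWith; take; drop; length; upTo; applyUpTo; concatMap)
open import Data.List.Properties using (map-cong; map-applyUpTo)
open import Data.Nat as ℕ using (ℕ; zero; suc; _∸_; s≤s)
import Data.Nat.Coprimality as Coprime
import Data.Nat.Properties as ℕP
open import Data.Product using (_×_; _,_)
open import Data.Rational using (ℚ; mkℚ; 0ℚ; 1ℚ; ½; _+_; _-_; _*_; -_; _≤_)
open import Data.Rational.Properties
  using (normalize-coprime; /-cong; nonNegative⁻¹; *-inverseʳ; +-mono-≤; +-assoc; +-inverseʳ)
open import Data.Rational.Solver
open import Data.Sum using ([_,_]; inj₁; inj₂)
open import Data.Vec using (_∷_; lookup)
open import Data.Vec.Properties using (lookup-zipWith; lookup-replicate; []=⇒lookup)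
open import Function using (_∘_; id)
open import Relation.Binary.PropositionalEquality
  using (_≡_; _≢_; refl; sym; trans; cong; cong₂; subst; module ≡-Reasoning)
open import Relation.Nullary using (yes; no)

ℕ→ℚ≡mkℚ : ∀ m → ℕ→ℚ m ≡ mkℚ (ℤ.+ m) 0 (Coprime.sym (Coprime.1-coprimeTo m))
ℕ→ℚ≡mkℚ m = normalize-coprime (Coprime.sym (Coprime.1-coprimeTo m))

ℕ→ℚ-+ : ∀ a b → ℕ→ℚ (a ℕ.+ b) ≡ ℕ→ℚ a + ℕ→ℚ b
ℕ→ℚ-+ a b rewrite ℕ→ℚ≡mkℚ a | ℕ→ℚ≡mkℚ b =
  /-cong (trans (ℤ.pos-+ a b) (sym (cong₂ ℤ._+_ (ℤ.*-identityʳ (ℤ.+ a)) (ℤ.*-identityʳ (ℤ.+ b))))) refl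

ℕ→ℚ-* : ∀ a b → ℕ→ℚ (a ℕ.* b) ≡ ℕ→ℚ a * ℕ→ℚ b
ℕ→ℚ-* a b rewrite ℕ→ℚ≡mkℚ a | ℕ→ℚ≡mkℚ b = /-cong (ℤ.pos-* a b) refl

ℕ→ℚ-nonNegative : ∀ m → 0ℚ ≤ ℕ→ℚ m
ℕ→ℚ-nonNegative m rewrite ℕ→ℚ≡mkℚ m = nonNegative⁻¹ _

ℕ→ℚ*recipℕ : ∀ m → ℕ→ℚ (suc m) * recipℕ (suc m) ≡ 1ℚ
ℕ→ℚ*recipℕ m rewrite ℕ→ℚ≡mkℚ (suc m) | normalize-coprime (Coprime.1-coprimeTo (suc m)) =
  *-inverseʳ (mkℚ (ℤ.+ suc m) 0 (Coprime.sym (Coprime.1-coprimeTo (suc m))))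

f-secondDifference : ∀ n a p q →
  f n (a ℕ.+ p ℕ.+ q) - f n (a ℕ.+ p) - f n (a ℕ.+ q) + f n a ≡ ℕ→ℚ (p ℕ.* q)
f-secondDifference n a p q
  rewrite ℕ→ℚ-+ (a ℕ.+ p) q | ℕ→ℚ-+ a p | ℕ→ℚ-+ a q | ℕ→ℚ-* p q =
  quadratic (ℕ→ℚ a) (ℕ→ℚ p) (ℕ→ℚ q) (ℕ→ℚ n) (recipℕ n)
  where
  open +-*-Solver
  quadratic : ∀ A P Q N r →
    let F = λ X → X * ((X - N) * ½ - r) in
    F (A + P + Q) - F (A + P) - F (A + Q) + F A ≡ P * Q
  quadratic = solve 5 (λ A P Q N r →
    let F = λ X → X :* ((X :- N) :* con ½ :- r) in
    F (A :+ P :+ Q) :- F (A :+ P) :- F (A :+ Q) :+ F A := P :* Q) refl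

f-diagonal : ∀ m → f (suc m) (suc m) ≡ - 1ℚ
f-diagonal m = trans (diagonal (ℕ→ℚ (suc m)) (recipℕ (suc m))) (cong -_ (ℕ→ℚ*recipℕ m))
  where
  open +-*-Solver
  diagonal : ∀ N r → N * ((N - N) * ½ - r) ≡ - (N * r)
  diagonal = solve 2 (λ N r → N :* ((N :- N) :* con ½ :- r) := :- (N :* r)) refl

lookup-⁅⁆-≢ : ∀ {n} {i j : Fin n} → i ≢ j → lookup ⁅ i ⁆ j ≡ false
lookup-⁅⁆-≢ {i = zero}  {zero}  i≢j = ⊥-elim (i≢j refl)
lookup-⁅⁆-≢ {i = zero}  {suc j} _   = lookup-replicate j false
lookup-⁅⁆-≢ {i = suc i} {zero}  _   = refl
lookup-⁅⁆-≢ {i = suc i} {suc j} i≢j = lookup-⁅⁆-≢ (i≢j ∘ cong suc)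

missing : ∀ {n} → Subset n → Fin n → ℕ
missing S i = if lookup S i then 0 else 1

∣∪⁅⁆∣ : ∀ {n} (S : Subset n) i → ∣ S ∪ ⁅ i ⁆ ∣ ≡ ∣ S ∣ ℕ.+ missing S i
∣∪⁅⁆∣ (true  ∷ S) zero    rewrite ∪-identityʳ S = cong suc (sym (ℕP.+-identityʳ ∣ S ∣))
∣∪⁅⁆∣ (false ∷ S) zero    rewrite ∪-identityʳ S = ℕP.+-comm 1 ∣ S ∣
∣∪⁅⁆∣ (true  ∷ S) (suc i) = cong suc (∣∪⁅⁆∣ S i)
∣∪⁅⁆∣ (false ∷ S) (suc i) = ∣∪⁅⁆∣ S i

missing-∪⁅⁆ : ∀ {n} (S : Subset n) {i j} → i ≢ j → missing (S ∪ ⁅ i ⁆) j ≡ missing S j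
missing-∪⁅⁆ S {i} {j} i≢j = cong (λ b → if b then 0 else 1) (begin
  lookup (S ∪ ⁅ i ⁆) j       ≡⟨ lookup-zipWith _∨_ j S ⁅ i ⁆ ⟩
  lookup S j ∨ lookup ⁅ i ⁆ j ≡⟨ cong (lookup S j ∨_) (lookup-⁅⁆-≢ i≢j) ⟩
  lookup S j ∨ false          ≡⟨ ∨-identityʳ (lookup S j) ⟩
  lookup S j                  ∎)
  where open ≡-Reasoning

∣∪⁅⁆∪⁅⁆∣ : ∀ {n} (S : Subset n) {i j} → i ≢ j →
  ∣ S ∪ (⁅ i ⁆ ∪ ⁅ j ⁆) ∣ ≡ ∣ S ∣ ℕ.+ missing S i ℕ.+ missing S j
∣∪⁅⁆∪⁅⁆∣ S {i} {j} i≢j = begin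
  ∣ S ∪ (⁅ i ⁆ ∪ ⁅ j ⁆) ∣                   ≡⟨ cong ∣_∣ (sym (∪-assoc S ⁅ i ⁆ ⁅ j ⁆)) ⟩
  ∣ (S ∪ ⁅ i ⁆) ∪ ⁅ j ⁆ ∣                   ≡⟨ ∣∪⁅⁆∣ (S ∪ ⁅ i ⁆) j ⟩
  ∣ S ∪ ⁅ i ⁆ ∣ ℕ.+ missing (S ∪ ⁅ i ⁆) j   ≡⟨ cong₂ ℕ._+_ (∣∪⁅⁆∣ S i) (missing-∪⁅⁆ S i≢j) ⟩
  ∣ S ∣ ℕ.+ missing S i ℕ.+ missing S j     ∎
  where open ≡-Reasoning

f∣∣-secondDifference : ∀ n (S : Subset n) {i j} → i ≢ j →
  (f n ∣ S ∪ (⁅ i ⁆ ∪ ⁅ j ⁆) ∣) - (f n ∣ S ∪ ⁅ i ⁆ ∣) - (f n ∣ S ∪ ⁅ j ⁆ ∣) + (f n ∣ S ∣)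
    ≡ ℕ→ℚ (missing S i ℕ.* missing S j)
f∣∣-secondDifference n S {i} {j} i≢j
  rewrite ∣∪⁅⁆∪⁅⁆∣ S i≢j | ∣∪⁅⁆∣ S i | ∣∪⁅⁆∣ S j = f-secondDifference n ∣ S ∣ (missing S i) (missing S j)

I-supermodular-H : ∀ {n} (L R : List (Fin n)) {i j} → i ≢ j →
  I-supermodular (H n) L i j R
    ≡ ℕ→ℚ (missing (setOf L) i ℕ.* missing (setOf L) j) + ℕ→ℚ (missing (setOf R) i ℕ.* missing (setOf R) j)
I-supermodular-H {n} L R {i} {j} i≢j =
  trans (regroup (F S) (F T) (F (S ∪ (⁅ i ⁆ ∪ ⁅ j ⁆))) (F (T ∪ (⁅ i ⁆ ∪ ⁅ j ⁆)))
                 (F (S ∪ ⁅ i ⁆)) (F (S ∪ ⁅ j ⁆)) (F (T ∪ ⁅ i ⁆)) (F (T ∪ ⁅ j ⁆)))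
        (cong₂ _+_ (f∣∣-secondDifference n S i≢j) (f∣∣-secondDifference n T i≢j))
  where
  S = setOf L
  T = setOf R
  F : Subset n → ℚ
  F X = f n ∣ X ∣
  open +-*-Solver
  regroup : ∀ s t sij tij si sj ti tj →
    ((s + tij) + 1ℚ) + ((sij + t) + 1ℚ) - ((si + tj) + 1ℚ) - ((sj + ti) + 1ℚ)
      ≡ (sij - si - sj + s) + (tij - ti - tj + t)
  regroup = solve 8 (λ s t sij tij si sj ti tj →
    ((s :+ tij) :+ con 1ℚ) :+ ((sij :+ t) :+ con 1ℚ) :- ((si :+ tj) :+ con 1ℚ) :- ((sj :+ ti) :+ con 1ℚ)
      := (sij :- si :- sj :+ s) :+ (tij :- ti :- tj :+ t)) refl

H-supermodular : ∀ {n} (L R : List (Fin n)) {i j} → i ≢ j → 0ℚ ≤ I-supermodular (H n) L i j R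
H-supermodular L R {i} {j} i≢j = subst (0ℚ ≤_) (sym (I-supermodular-H L R i≢j))
  (+-mono-≤ (ℕ→ℚ-nonNegative (missing S i ℕ.* missing S j)) (ℕ→ℚ-nonNegative (missing T i ℕ.* missing T j)))
  where
  S = setOf L
  T = setOf R

count-++ : ∀ {n} (z : Fin n) xs ys → count z (xs ++ ys) ≡ count z xs ℕ.+ count z ys
count-++ z []       ys = refl
count-++ z (x ∷ xs) ys with z ≟ x
... | yes _ = cong suc (count-++ z xs ys)
... | no  _ = count-++ z xs ys

count-here : ∀ {n} (x : Fin n) l → count x (x ∷ l) ≡ suc (count x l)
count-here x l with x ≟ x
... | yes _   = refl
... | no  x≢x = ⊥-elim (x≢x refl)

count-there : ∀ {n} {z x : Fin n} → z ≢ x → ∀ l → count z (x ∷ l) ≡ count z l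
count-there {z = z} {x} z≢x l with z ≟ x
... | yes z≡x = ⊥-elim (z≢x z≡x)
... | no  _   = refl

doubleIf : ∀ {n} → (Fin n → Bool) → Fin n → List (Fin n)
doubleIf g x = if g x then x ∷ x ∷ [] else x ∷ []

count-doubleIf-[x] : ∀ {n} (g : Fin n → Bool) z x →
  count z (doubleIf g x) ≡ (if g z then 2 else 1) ℕ.* count z (x ∷ [])
count-doubleIf-[x] g z x with z ≟ x
... | yes refl with g z
...   | true  rewrite count-here z (z ∷ []) | count-here z [] = refl
...   | false rewrite count-here z [] = refl
count-doubleIf-[x] g z x | no z≢x with g x
...   | true  rewrite count-there z≢x (x ∷ []) | count-there z≢x [] = sym (ℕP.*-zeroʳ (if g z then 2 else 1))
...   | false rewrite count-there z≢x [] = sym (ℕP.*-zeroʳ (if g z then 2 else 1))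

count-doubleIf : ∀ {n} (g : Fin n → Bool) z l →
  count z (concatMap (doubleIf g) l) ≡ (if g z then 2 else 1) ℕ.* count z l
count-doubleIf g z [] = sym (ℕP.*-zeroʳ (if g z then 2 else 1))
count-doubleIf g z (x ∷ l) = begin
  count z (doubleIf g x ++ concatMap (doubleIf g) l)
    ≡⟨ count-++ z (doubleIf g x) (concatMap (doubleIf g) l) ⟩
  count z (doubleIf g x) ℕ.+ count z (concatMap (doubleIf g) l)
    ≡⟨ cong₂ ℕ._+_ (count-doubleIf-[x] g z x) (count-doubleIf g z l) ⟩
  k ℕ.* count z (x ∷ []) ℕ.+ k ℕ.* count z l
    ≡⟨ sym (ℕP.*-distribˡ-+ k (count z (x ∷ [])) (count z l)) ⟩
  k ℕ.* (count z (x ∷ []) ℕ.+ count z l)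
    ≡⟨ cong (k ℕ.*_) (sym (count-++ z (x ∷ []) l)) ⟩
  k ℕ.* count z (x ∷ l) ∎
  where
  open ≡-Reasoning
  k = if g z then 2 else 1

count-bar : ∀ {n} (c : List (Fin n)) → (∀ z → 1 ℕ.≤ count z c × count z c ℕ.≤ 2) → ∀ z → count z (bar c) ≡ 2
count-bar c bounds z with count z c | bounds z | count-doubleIf (λ x → count x c ℕ.≡ᵇ 1) z c
... | 1                 | _                 | doubled = doubled
... | 2                 | _                 | doubled = doubled
... | 0                 | () , _            | _
... | suc (suc (suc _)) | _ , s≤s (s≤s ()) | _

occ-map-⁅⁆ : ∀ {n} (z : Fin n) c → occ z (map ⁅_⁆ c) ≡ count z c
occ-map-⁅⁆ z [] = refl
occ-map-⁅⁆ z (x ∷ c) with z ≟ x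
... | yes refl rewrite []=⇒lookup (x∈⁅x⁆ z) = cong suc (occ-map-⁅⁆ z c)
... | no  z≢x  rewrite lookup-⁅⁆-≢ (z≢x ∘ sym) = occ-map-⁅⁆ z c

count≢0⇒∈setOf : ∀ {n} {z : Fin n} w → count z w ≢ 0 → z ∈ setOf w
count≢0⇒∈setOf [] c≢0 = ⊥-elim (c≢0 refl)
count≢0⇒∈setOf {z = z} (x ∷ w) c≢0 with z ≟ x
... | yes refl = x∈p∪q⁺ (inj₁ (x∈⁅x⁆ z))
... | no  _    = x∈p∪q⁺ (inj₂ (count≢0⇒∈setOf w c≢0))

∈⇒∪⁅⁆≡ : ∀ {n} {x : Fin n} {P} → x ∈ P → P ∪ ⁅ x ⁆ ≡ P
∈⇒∪⁅⁆≡ {x = x} {P} x∈P = ⊆-antisym (λ z∈ → [ id , x∈ ] (x∈p∪q⁻ P ⁅ x ⁆ z∈)) (p⊆p∪q ⁅ x ⁆)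
  where
  x∈ : ∀ {z} → z ∈ ⁅ x ⁆ → z ∈ P
  x∈ z∈⁅x⁆ = subst (_∈ P) (sym (x∈⁅y⁆⇒x≡y x z∈⁅x⁆)) x∈P

∀∈⇒≡⊤ : ∀ {n} {P : Subset n} → (∀ z → z ∈ P) → P ≡ ⊤
∀∈⇒≡⊤ all = ⊆-antisym ⊆⊤ (λ {z} _ → all z)

barred : ∀ {n} → List (Fin n) → Fin n → Bool
barred seen x = 1 ℕ.≤ᵇ count x seen

count≢0⇒barred : ∀ {n} (seen : List (Fin n)) {z} → count z seen ≢ 0 → barred seen z ≡ true
count≢0⇒barred seen {z} c≢0 with count z seen
... | zero  = ⊥-elim (c≢0 refl)
... | suc _ = refl

unbarred⇒count≡0 : ∀ {n} (seen : List (Fin n)) {z} → barred seen z ≡ false → count z seen ≡ 0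
unbarred⇒count≡0 seen {z} unbarred with count z seen
... | zero = refl
unbarred⇒count≡0 seen () | suc _

cut : ∀ {n} → (Subset n → Subset n → ℚ) → Subset n → List (Fin n) → ℕ → ℚ
cut h P w k = h (P ∪ setOf (take (suc k) w)) (setOf (drop (suc k) w))

-- I-updown restricted to the positions inside a suffix w of B̄: P is the set of the letters
-- before w, and seen lists them (reversed), which is all that barredFlags looks at.
updownFrom : ∀ {n} → (Subset n → Subset n → ℚ) → Subset n → List (Fin n) → List (Fin n) → ℚ
updownFrom h P seen w =
  sumℚ (zipWith _*_ (consecutiveWeights (barredFlags seen w)) (map (cut h P w) (upTo (length w ∸ 1))))

I-updown≡updownFrom : ∀ {n} (h : Subset n → Subset n → ℚ) c → I-updown h c ≡ updownFrom h ⊥ [] (bar c)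
I-updown≡updownFrom h c = cong (λ hs → sumℚ (zipWith _*_ (consecutiveWeights (barredFlags [] (bar c))) hs))
  (map-cong (λ k → cong (λ S → h S (setOf (drop (suc k) (bar c)))) (sym (∪-identityˡ _))) (upTo (length (bar c) ∸ 1)))

updownFrom-∷∷ : ∀ {n} (h : Subset n → Subset n → ℚ) P seen x y w →
  updownFrom h P seen (x ∷ y ∷ w)
    ≡ weight (barred seen x) (barred (x ∷ seen) y) * h (P ∪ ⁅ x ⁆) (setOf (y ∷ w))
      + updownFrom h (P ∪ ⁅ x ⁆) (x ∷ seen) (y ∷ w)
updownFrom-∷∷ h P seen x y w =
  cong₂ (λ u hs → weight (barred seen x) (barred (x ∷ seen) y) * u
                  + sumℚ (zipWith _*_ (consecutiveWeights (barredFlags (x ∷ seen) (y ∷ w))) hs))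
        (cong (λ S → h (P ∪ S) (setOf (y ∷ w))) (∪-identityʳ ⁅ x ⁆))
        shiftedCuts
  where
  open ≡-Reasoning
  m = length w
  shiftedCuts : map (cut h P (x ∷ y ∷ w)) (applyUpTo suc m) ≡ map (cut h (P ∪ ⁅ x ⁆) (y ∷ w)) (upTo m)
  shiftedCuts = begin
    map (cut h P (x ∷ y ∷ w)) (applyUpTo suc m)     ≡⟨ map-applyUpTo suc (cut h P (x ∷ y ∷ w)) m ⟩
    applyUpTo (cut h P (x ∷ y ∷ w) ∘ suc) m         ≡⟨ sym (map-applyUpTo id (cut h P (x ∷ y ∷ w) ∘ suc) m) ⟩
    map (cut h P (x ∷ y ∷ w) ∘ suc) (upTo m)        ≡⟨ map-cong (λ k → cong (λ S → h S (setOf (drop (suc k) (y ∷ w))))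
                                                                   (sym (∪-assoc P ⁅ x ⁆ _))) (upTo m) ⟩
    map (cut h (P ∪ ⁅ x ⁆) (y ∷ w)) (upTo m)         ∎

record Balanced {n} (P : Subset n) (seen rest : List (Fin n)) : Set where
  field
    twice    : ∀ z → count z seen ℕ.+ count z rest ≡ 2
    barred⇒∈ : ∀ z → barred seen z ≡ true → z ∈ P

open Balanced

Balanced-∷ : ∀ {n} {P : Subset n} {seen x w} → Balanced P seen (x ∷ w) → Balanced (P ∪ ⁅ x ⁆) (x ∷ seen) w
Balanced-∷ {P = P} {seen} {x} {w} bal = record { twice = twice′ ; barred⇒∈ = barred⇒∈′ }
  where
  twice′ : ∀ z → count z (x ∷ seen) ℕ.+ count z w ≡ 2
  twice′ z with z ≟ x | twice bal z
  ... | yes _ | twice-z = trans (sym (ℕP.+-suc (count z seen) (count z w))) twice-z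
  ... | no  _ | twice-z = twice-z
  barred⇒∈′ : ∀ z → barred (x ∷ seen) z ≡ true → z ∈ P ∪ ⁅ x ⁆
  barred⇒∈′ z with z ≟ x | barred⇒∈ bal z
  ... | yes refl | _      = λ _ → x∈p∪q⁺ (inj₂ (x∈⁅x⁆ z))
  ... | no  _    | z∈P    = x∈p∪q⁺ ∘ inj₁ ∘ z∈P

≢0-beside-singleton : ∀ {n} {z x : Fin n} k → k ℕ.+ count z (x ∷ []) ≡ 2 → k ≢ 0
≢0-beside-singleton {z = z} {x} k sum≡2 refl with z ≟ x
≢0-beside-singleton _ () refl | yes _
≢0-beside-singleton _ () refl | no  _

Balanced-last : ∀ {n} {P : Subset n} {seen x} → Balanced P seen (x ∷ []) → ∀ z → barred seen z ≡ true
Balanced-last {seen = seen} {x} bal z =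
  count≢0⇒barred seen (≢0-beside-singleton {z = z} {x} (count z seen) (twice bal z))

Balanced-unbarred : ∀ {n} {P : Subset n} {seen y w} → Balanced P seen (y ∷ w) → barred seen y ≡ false → y ∈ setOf w
Balanced-unbarred {seen = seen} {y} {w} bal unbarred = count≢0⇒∈setOf w count≢0
  where
  once : count y w ≡ 1
  once = ℕP.suc-injective
    (trans (sym (cong₂ ℕ._+_ (unbarred⇒count≡0 seen unbarred) (count-here y w))) (twice bal y))
  count≢0 : count y w ≢ 0
  count≢0 c≡0 = ℕP.0≢1+n (trans (sym c≡0) once)

weight-telescope : ∀ bx by (α α′ β β′ τ : ℚ) → (bx ≡ true → α′ ≡ α) → (by ≡ false → β ≡ β′) →
  weight bx by * (α′ + β) + ((if by then α′ else - β′) - τ) ≡ (if bx then α else - β) - τ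
weight-telescope true  true  α α′ β β′ τ α′≡α _    rewrite α′≡α refl = solve 3 (λ α β τ →
  con 0ℚ :* (α :+ β) :+ (α :- τ) := α :- τ) refl α β τ
  where open +-*-Solver
weight-telescope false true  α α′ β β′ τ _    _    = solve 3 (λ α′ β τ →
  con (- 1ℚ) :* (α′ :+ β) :+ (α′ :- τ) := :- β :- τ) refl α′ β τ
  where open +-*-Solver
weight-telescope true  false α α′ β β′ τ α′≡α β≡β′ rewrite α′≡α refl | β≡β′ refl = solve 3 (λ α β′ τ →
  con 1ℚ :* (α :+ β′) :+ (:- β′ :- τ) := α :- τ) refl α β′ τ
  where open +-*-Solver
weight-telescope false false α α′ β β′ τ _    β≡β′ rewrite β≡β′ refl = solve 3 (λ α′ β′ τ →
  con 0ℚ :* (α′ :+ β′) :+ (:- β′ :- τ) := :- β′ :- τ) refl α′ β′ τ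
  where open +-*-Solver

module _ {n} {h : Subset n → Subset n → ℚ} (φ ψ : Subset n → ℚ) (split : ∀ S T → h S T ≡ φ S + ψ T) where

  updownFrom-split : ∀ {P seen} x w → Balanced P seen (x ∷ w) →
    updownFrom h P seen (x ∷ w) ≡ (if barred seen x then φ P else - ψ (setOf w)) - φ ⊤
  updownFrom-split {P} {seen} x [] bal = begin
    0ℚ                                             ≡⟨ sym (+-inverseʳ (φ ⊤)) ⟩
    φ ⊤ - φ ⊤                                      ≡⟨ cong (λ S → φ S - φ ⊤) (sym (∀∈⇒≡⊤ (λ z → barred⇒∈ bal z (Balanced-last bal z)))) ⟩
    φ P - φ ⊤                                      ≡⟨ cong (λ b → (if b then φ P else - ψ ⊥) - φ ⊤) (sym (Balanced-last bal x)) ⟩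
    (if barred seen x then φ P else - ψ ⊥) - φ ⊤   ∎
    where open ≡-Reasoning
  updownFrom-split {P} {seen} x (y ∷ w) bal = begin
    updownFrom h P seen (x ∷ y ∷ w)
      ≡⟨ updownFrom-∷∷ h P seen x y w ⟩
    weight bx by * h P′ (setOf (y ∷ w)) + updownFrom h P′ (x ∷ seen) (y ∷ w)
      ≡⟨ cong₂ (λ u v → weight bx by * u + v) (split P′ (setOf (y ∷ w))) (updownFrom-split y w bal′) ⟩
    weight bx by * (φ P′ + ψ (setOf (y ∷ w))) + ((if by then φ P′ else - ψ (setOf w)) - φ ⊤)
      ≡⟨ weight-telescope bx by (φ P) (φ P′) (ψ (setOf (y ∷ w))) (ψ (setOf w)) (φ ⊤)
           (cong φ ∘ ∈⇒∪⁅⁆≡ ∘ barred⇒∈ bal x)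
           (λ unbarred → cong ψ (trans (∪-comm ⁅ y ⁆ (setOf w)) (∈⇒∪⁅⁆≡ (Balanced-unbarred bal′ unbarred)))) ⟩
    (if bx then φ P else - ψ (setOf (y ∷ w))) - φ ⊤ ∎
    where
    open ≡-Reasoning
    P′ = P ∪ ⁅ x ⁆
    bal′ = Balanced-∷ bal
    bx = barred seen x
    by = barred (x ∷ seen) y

  updownFrom-split-⊥ : ∀ x w → (∀ z → count z (x ∷ w) ≡ 2) → updownFrom h ⊥ [] (x ∷ w) ≡ - ψ ⊤ - φ ⊤
  updownFrom-split-⊥ x w twice-all = begin
    updownFrom h ⊥ [] (x ∷ w)  ≡⟨ updownFrom-split x w initial ⟩
    - ψ (setOf w) - φ ⊤        ≡⟨ cong (λ S → - ψ S - φ ⊤) (∀∈⇒≡⊤ (λ z → count≢0⇒∈setOf w (remaining z))) ⟩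
    - ψ ⊤ - φ ⊤                ∎
    where
    open ≡-Reasoning
    initial : Balanced ⊥ [] (x ∷ w)
    initial = record { twice = twice-all ; barred⇒∈ = λ _ () }
    remaining : ∀ z → count z w ≢ 0
    remaining z = ≢0-beside-singleton {z = z} {x} (count z w)
      (trans (ℕP.+-comm (count z w) (count z (x ∷ []))) (twice (Balanced-∷ initial) z))

I-updown-H : ∀ m (c : List (Fin (suc m))) → (∀ z → count z (bar c) ≡ 2) → I-updown (H (suc m)) c ≡ 1ℚ
I-updown-H m c twice-all = trans (I-updown≡updownFrom (H n) c) (value (bar c) twice-all)
  where
  n = suc m
  φ ψ : Subset n → ℚ
  φ S = f n ∣ S ∣
  ψ T = f n ∣ T ∣ + 1ℚ
  value : ∀ w → (∀ z → count z w ≡ 2) → updownFrom (H n) ⊥ [] w ≡ 1ℚ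
  value []      twice-all = ⊥-elim (ℕP.0≢1+n (twice-all zero))
  value (x ∷ w) twice-all = begin
    updownFrom (H n) ⊥ [] (x ∷ w)  ≡⟨ updownFrom-split-⊥ φ ψ (λ S T → +-assoc (φ S) (f n ∣ T ∣) 1ℚ) x w twice-all ⟩
    - ψ ⊤ - φ ⊤                    ≡⟨ cong (λ k → - (f n k + 1ℚ) - f n k) (∣⊤∣≡n n) ⟩
    - (f n n + 1ℚ) - f n n         ≡⟨ cong (λ t → - (t + 1ℚ) - t) (f-diagonal m) ⟩
    - (- 1ℚ + 1ℚ) - - 1ℚ           ≡⟨⟩
    1ℚ                             ∎
    where open ≡-Reasoning

IsBisequence-count : ∀ {n} {c : List (Fin n)} → IsBisequence (map ⁅_⁆ c) →
  ∀ z → 1 ℕ.≤ count z c × count z c ℕ.≤ 2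
IsBisequence-count {c = c} (_ , bounds , _) z = subst (λ k → 1 ℕ.≤ k × k ℕ.≤ 2) (occ-map-⁅⁆ z c) (bounds z)

proposition9p2 : (n : ℕ) → 2 ℕ.≤ n →
    ((L R : List (Fin n)) (i j : Fin n) → i ≢ j →
       IsBisequence (supermodularBisequence L i j R) →
       length (supermodularBisequence L i j R) ≡ 2 ℕ.* n ∸ 2 →
       0ℚ ≤ I-supermodular (H n) L i j R)
    ×
    ((c : List (Fin n)) →
       IsBisequence (map ⁅_⁆ c) →
       length c ≡ 2 ℕ.* n ∸ 2 →
       0ℚ ≤ I-updown (H n) c)
proposition9p2 zero ()
proposition9p2 (suc m) _ =
    (λ L R i j i≢j _ _ → H-supermodular L R i≢j)
  , λ c bisequence _ →
      subst (0ℚ ≤_) (sym (I-updown-H m c (count-bar c (IsBisequence-count bisequence)))) (nonNegative⁻¹ 1ℚ)
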